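{- For all integers $n\ge1$, $k\ge1$ and positive integers $a,b$, $$\mathrm{spt}_{(a,b)}(n,k)=\left\lfloor\frac nk\right\rfloor^a\left\lfloor\frac{k\lfloor n/k\rfloor}{n}\right\rfloor\left(k^b-(k-1)^b\right)+\sum_{m=1}^{\lfloor n/k\rfloor}m^a\sum_{\nu=1}^{k-1}(k-\nu)^b\,p(n-km,\nu),$$ and consequently $$\mathrm{spt}_{(a,b)}(n)=\sum_{k=1}^{n}\left(\left\lfloor\frac nk\right\rfloor^a\left\lfloor\frac{k\lfloor n/k\rfloor}{n}\right\rfloor\left(k^b-(k-1)^b\right)+\sum_{m=1}^{\lfloor n/k\rfloor}m^a\sum_{\nu=1}^{k-1}(k-\nu)^b\,p(n-km,\nu)\right).$$
   Context: $p(n,k)$ is the number of partitions of $n$ into exactly $k$ positive parts, with the conventions $p(0,1)=1$ and $p(n,k)=0$ if $n<0$, $k<1$, or $k>n$. For a partition $\lambda$, $\sigma(\lambda)$ is its smallest part and $\#(\lambda)$ the number of parts equal to $\sigma(\lambda)$. $\mathrm{spt}_{(a,b)}(n,k)=\sum_{\lambda}\sigma(\lambda)^a\#(\lambda)^b$ over all partitions $\lambda$ of $n$ into exactly $k$ parts, and $\mathrm{spt}_{(a,b)}(n)=\sum_{\lambda}\sigma(\lambda)^a\#(\lambda)^b$ over all partitions $\lambda$ of $n$. The paper's standing convention is that variables range over positive integers. -}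

module Defs where

open import Data.Nat using (ℕ; zero; suc; _+_; _*_; _∸_; _^_; _≥_; _⊓_)
open import Data.Nat.Properties using (_≟_; _≥?_)
open import Data.List using (List; []; _∷_; map; concatMap; filter; length; applyUpTo; foldr)
open import Data.Nat.ListAction using (sum)
open import Data.List.Relation.Unary.Linked using (Linked; linked?)
open import Relation.Binary.PropositionalEquality using (_≡_)
open import Relation.Nullary using (Dec)
open import Relation.Nullary.Decidable using (_×-dec_)
open import Data.Product using (_×_)

-- [a..b] as a list (empty if b < a)
fromTo : ℕ → ℕ → List ℕ
fromTo a b = applyUpTo (λ i → a + i) (suc b ∸ a)

Σ[_⋯_] : ℕ → ℕ → (ℕ → ℕ) → ℕ
Σ[ a ⋯ b ] f = sum (map f (fromTo a b))

candidates : ℕ → ℕ → List (List ℕ)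
candidates n zero    = [] ∷ []
candidates n (suc k) = concatMap (λ x → map (x ∷_) (candidates n k)) (fromTo 1 n)

-- a partition is represented as a non-increasing list of positive parts
IsPartitionOf : ℕ → List ℕ → Set
IsPartitionOf n λ′ = Linked _≥_ λ′ × sum λ′ ≡ n

isPartitionOf? : (n : ℕ) → (l : List ℕ) → Dec (IsPartitionOf n l)
isPartitionOf? n l = linked? _≥?_ l ×-dec (sum l ≟ n)

partitionsInto : ℕ → ℕ → List (List ℕ)
partitionsInto n k = filter (isPartitionOf? n) (candidates n k)

partitions : ℕ → List (List ℕ)
partitions n = filter (isPartitionOf? n) (concatMap (candidates n) (fromTo 0 n))

-- p(n,k) with the paper's conventions: p(0,1) = 1, p(n,k) = 0 if k < 1 (or k > n, automatic)
p : ℕ → ℕ → ℕ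
p zero (suc zero) = 1
p n zero = 0
p n k = length (partitionsInto n k)

σ : List ℕ → ℕ
σ []       = 0
σ (x ∷ xs) = foldr _⊓_ x xs

#_ : List ℕ → ℕ
# l = length (filter (λ x → x ≟ σ l) l)

weight : ℕ → ℕ → List ℕ → ℕ
weight a b l = σ l ^ a * (# l) ^ b

spt[_,_]⟨_,_⟩ : ℕ → ℕ → ℕ → ℕ → ℕ
spt[ a , b ]⟨ n , k ⟩ = sum (map (weight a b) (partitionsInto n k))

spt[_,_]⟨_⟩ : ℕ → ℕ → ℕ → ℕ
spt[ a , b ]⟨ n ⟩ = sum (map (weight a b) (partitions n))

{-# OPTIONS --safe #-}

-- A partition of n into k parts whose smallest part m occurs exactly k − ν times (1 ≤ m ≤ ⌊n/k⌋,
-- 0 ≤ ν < k) arises from a unique partition of n − k m into ν parts, by adding m to each of its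
-- parts and appending k − ν copies of m. Hence
--   spt_(a,b)(n,k) = Σ_m m^a Σ_{ν<k} (k − ν)^b p*(n − k m, ν),
-- where p* counts partitions exactly. The paper's p differs from p* only in p(0,0) = 0 and
-- p(0,1) = 1; both matter only when n = k m, i.e. m = ⌊n/k⌋ and k ∣ n, which ⌊k⌊n/k⌋/n⌋ detects,
-- and together they account for the term ⌊n/k⌋^a ⌊k⌊n/k⌋/n⌋ (k^b − (k−1)^b).

module Submission where

open import Defs
open import Data.Nat using (ℕ; suc; _+_; _*_; _∸_; _^_; _≤_; _/_; NonZero)
open import Data.Product using (_×_)
open import Relation.Binary.PropositionalEquality using (_≡_)

open import Data.Nat using (zero; _<_; _≥_; _≟_; s≤s; s≤s⁻¹; z≤n)
open import Data.Nat.Properties hiding (_≟_)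
open import Data.Nat.DivMod using (m*n/n≡m; m/n*n≤m; /-monoˡ-≤; m<n⇒m/n≡0; n/n≡1; 0/n≡0)
open import Data.Nat.ListAction using (sum)
open import Data.Nat.ListAction.Properties using (sum-++; sum-↭)
open import Data.Nat.Tactic.RingSolver using (solve-∀)
open import Algebra.Properties.CommutativeSemigroup +-commutativeSemigroup using (interchange)
open import Data.List using (List; []; _∷_; _++_; [_]; map; concatMap; cartesianProductWith; filter; length; applyUpTo; replicate)
import Data.List.Properties as List
open import Data.List.Relation.Unary.All as All using (All; []; _∷_)
import Data.List.Relation.Unary.All.Properties as All
open import Data.List.Relation.Unary.Any as Any using (Any; here; there)
open import Data.List.Relation.Unary.AllPairs using ([]; _∷_)
open import Data.List.Relation.Unary.Linked as Linked using (Linked; []; [-]; _∷_)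
import Data.List.Relation.Unary.Linked.Properties as Linked
open import Data.List.Relation.Unary.Unique.Propositional using (Unique)
import Data.List.Relation.Unary.Unique.Propositional.Properties as Unique
open import Data.List.Membership.Propositional using (_∈_; find; lose)
open import Data.List.Membership.Propositional.Properties
open import Data.List.Membership.Propositional.Properties.WithK using (unique∧set⇒bag)
open import Data.List.Relation.Binary.BagAndSetEquality using (∼bag⇒↭)
import Data.List.Relation.Binary.Permutation.Propositional.Properties as ↭
import Data.Product
open import Data.Product using (proj₁; proj₂; ∃; ∃₂)
open import Data.Sum using (_⊎_; inj₁; inj₂; [_,_]′)
open import Data.Empty using (⊥)
open import Function.Base using (_∘_; id)
open import Function.Bundles using (mk⇔)
open import Relation.Nullary using (yes; no)
open import Relation.Unary using (Decidable)
open import Relation.Binary.PropositionalEquality using (refl; sym; trans; cong; cong₂; subst; subst₂; module ≡-Reasoning)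

-- Data.Product._,_ stays out of the top-level scope, where it would make the mixfix
-- spt[ a , b ]⟨ n , k ⟩ of the theorem ambiguous.
module _ where

  open Data.Product using (_,_)

  module _ {A : Set} where

    sum-map-cong-∈ : ∀ {f g : A → ℕ} xs → (∀ {x} → x ∈ xs → f x ≡ g x) → sum (map f xs) ≡ sum (map g xs)
    sum-map-cong-∈ xs f≡g = cong sum (List.map-cong-local (All.tabulate f≡g))

    sum-map-+ : ∀ (f g : A → ℕ) xs → sum (map (λ x → f x + g x) xs) ≡ sum (map f xs) + sum (map g xs)
    sum-map-+ f g [] = refl
    sum-map-+ f g (x ∷ xs) rewrite sum-map-+ f g xs = interchange (f x) (g x) _ _

    sum-map-*ˡ : ∀ c (f : A → ℕ) xs → sum (map (λ x → c * f x) xs) ≡ c * sum (map f xs)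
    sum-map-*ˡ c f [] = sym (*-zeroʳ c)
    sum-map-*ˡ c f (x ∷ xs) rewrite sum-map-*ˡ c f xs = sym (*-distribˡ-+ c (f x) _)

    sum-map-const : ∀ c (xs : List A) → sum (map (λ _ → c) xs) ≡ c * length xs
    sum-map-const c [] = sym (*-zeroʳ c)
    sum-map-const c (x ∷ xs) rewrite sum-map-const c xs = sym (*-suc c (length xs))

    sum-map-concatMap : ∀ {B : Set} (f : B → ℕ) (g : A → List B) xs →
      sum (map f (concatMap g xs)) ≡ sum (map (λ x → sum (map f (g x))) xs)
    sum-map-concatMap f g [] = refl
    sum-map-concatMap f g (x ∷ xs) = begin
      sum (map f (g x ++ concatMap g xs))              ≡⟨ cong sum (List.map-++ f (g x) _) ⟩
      sum (map f (g x) ++ map f (concatMap g xs))      ≡⟨ sum-++ (map f (g x)) _ ⟩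
      sum (map f (g x)) + sum (map f (concatMap g xs)) ≡⟨ cong (sum (map f (g x)) +_) (sum-map-concatMap f g xs) ⟩
      sum (map f (g x)) + sum (map (λ x → sum (map f (g x))) xs) ∎
      where open ≡-Reasoning

    unique∧set⇒sum-map≡ : ∀ (f : A → ℕ) {xs ys} → Unique xs → Unique ys →
      (∀ {x} → x ∈ xs → x ∈ ys) → (∀ {x} → x ∈ ys → x ∈ xs) → sum (map f xs) ≡ sum (map f ys)
    unique∧set⇒sum-map≡ f ux uy to from =
      sum-↭ (↭.map⁺ f (∼bag⇒↭ (unique∧set⇒bag ux uy (mk⇔ to from))))

    filter-concatMap : ∀ {B : Set} {P : B → Set} (P? : Decidable P) (g : A → List B) xs →
      filter P? (concatMap g xs) ≡ concatMap (λ x → filter P? (g x)) xs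
    filter-concatMap P? g [] = refl
    filter-concatMap P? g (x ∷ xs) =
      trans (List.filter-++ P? (g x) _) (cong (filter P? (g x) ++_) (filter-concatMap P? g xs))

    Unique-concatMap : ∀ {B : Set} (g : A → List B) (label : B → A) {xs} → Unique xs →
      (∀ {x} → x ∈ xs → Unique (g x)) → (∀ {x z} → x ∈ xs → z ∈ g x → label z ≡ x) →
      Unique (concatMap g xs)
    Unique-concatMap g label [] _ _ = []
    Unique-concatMap g label {x ∷ xs} (x∉xs ∷ uxs) ug lab =
      Unique.++⁺ (ug (here refl)) (Unique-concatMap g label uxs (ug ∘ there) (lab ∘ there)) disjoint
      where
        disjoint : ∀ {z} → z ∈ g x × z ∈ concatMap g xs → ⊥
        disjoint (z∈gx , z∈gxs) with y , y∈xs , z∈gy ← find (∈-concatMap⁻ g z∈gxs) =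
          All.lookup x∉xs y∈xs (trans (sym (lab (here refl) z∈gx)) (lab (there y∈xs) z∈gy))

  sum-replicate : ∀ r m → sum (replicate r m) ≡ r * m
  sum-replicate zero m = refl
  sum-replicate (suc r) m = cong (m +_) (sum-replicate r m)

  ∈⇒≤sum : ∀ {x xs} → x ∈ xs → x ≤ sum xs
  ∈⇒≤sum {xs = y ∷ ys} (here refl) = m≤m+n y (sum ys)
  ∈⇒≤sum {xs = y ∷ ys} (there x∈) = ≤-trans (∈⇒≤sum x∈) (m≤n+m (sum ys) y)

  ∈-fromTo⁻ : ∀ {a b x} → x ∈ fromTo a b → a ≤ x × x ≤ b
  ∈-fromTo⁻ {a} {b} x∈ with i , i<len , refl ← ∈-applyUpTo⁻ (a +_) x∈ =
    m≤m+n a i , subst (_≤ b) (+-comm i a) (s≤s⁻¹ (m≤o∸n⇒m+n≤o (suc i) a≤1+b i<len))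
    where
      a≤1+b : a ≤ suc b
      a≤1+b = <⇒≤ (m∸n≢0⇒n<m (λ len≡0 → n≮0 (subst (i <_) len≡0 i<len)))

  ∈-fromTo⁺ : ∀ {a b x} → a ≤ x → x ≤ b → x ∈ fromTo a b
  ∈-fromTo⁺ {a} {b} a≤x x≤b =
    subst (_∈ fromTo a b) (m+[n∸m]≡n a≤x) (∈-applyUpTo⁺ (a +_) (∸-monoˡ-< (s≤s x≤b) a≤x))

  Unique-fromTo : ∀ a b → Unique (fromTo a b)
  Unique-fromTo a b = Unique.applyUpTo⁺₁ (a +_) _ (λ i<j _ → <⇒≢ i<j ∘ +-cancelˡ-≡ a _ _)

  Σ-cong : ∀ {a b} {f g : ℕ → ℕ} → (∀ {i} → a ≤ i → i ≤ b → f i ≡ g i) → Σ[ a ⋯ b ] f ≡ Σ[ a ⋯ b ] g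
  Σ-cong f≡g = sum-map-cong-∈ _ (λ i∈ → let a≤i , i≤b = ∈-fromTo⁻ i∈ in f≡g a≤i i≤b)

  Σ-snoc : ∀ {a b} (f : ℕ → ℕ) → a ≤ suc b → Σ[ a ⋯ suc b ] f ≡ Σ[ a ⋯ b ] f + f (suc b)
  Σ-snoc {a} {b} f a≤1+b = begin
    sum (map f (applyUpTo (a +_) (suc (suc b) ∸ a)))
      ≡⟨ cong (sum ∘ map f ∘ applyUpTo (a +_)) (+-∸-assoc 1 a≤1+b) ⟩
    sum (map f (applyUpTo (a +_) (suc (suc b ∸ a))))
      ≡⟨ cong (sum ∘ map f) (sym (List.applyUpTo-∷ʳ (a +_) (suc b ∸ a))) ⟩
    sum (map f (fromTo a b ++ [ a + (suc b ∸ a) ]))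
      ≡⟨ cong sum (List.map-++ f (fromTo a b) _) ⟩
    sum (map f (fromTo a b) ++ [ f (a + (suc b ∸ a)) ])
      ≡⟨ sum-++ (map f (fromTo a b)) _ ⟩
    Σ[ a ⋯ b ] f + (f (a + (suc b ∸ a)) + 0)
      ≡⟨ cong (Σ[ a ⋯ b ] f +_) (trans (+-identityʳ _) (cong f (m+[n∸m]≡n a≤1+b))) ⟩
    Σ[ a ⋯ b ] f + f (suc b) ∎
    where open ≡-Reasoning

  Σ-shift : ∀ a b (f : ℕ → ℕ) → Σ[ suc a ⋯ suc b ] f ≡ Σ[ a ⋯ b ] (f ∘ suc)
  Σ-shift a b f = cong sum (trans (List.map-applyUpTo (suc a +_) f (suc b ∸ a))
                                  (sym (List.map-applyUpTo (a +_) (f ∘ suc) (suc b ∸ a))))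

  k*[n/k]≤n : ∀ n k .{{_ : NonZero k}} → k * (n / k) ≤ n
  k*[n/k]≤n n k = subst (_≤ n) (*-comm (n / k) k) (m/n*n≤m n k)

  k*m≤n⇒m≤n/k : ∀ {k m n} .{{_ : NonZero k}} → k * m ≤ n → m ≤ n / k
  k*m≤n⇒m≤n/k {k} {m} {n} km≤n = subst (_≤ n / k) (m*n/n≡m m k) (/-monoˡ-≤ k (subst (_≤ n) (*-comm k m) km≤n))

  ν≤k⇒0<1+k∸ν : ∀ {ν k} → ν ≤ k → 0 < suc k ∸ ν
  ν≤k⇒0<1+k∸ν ν≤k = m<n⇒0<n∸m (s≤s ν≤k)

  candidates-suc : ∀ N k → candidates N (suc k) ≡ cartesianProductWith _∷_ (fromTo 1 N) (candidates N k)
  candidates-suc N k = concatMap-map (fromTo 1 N)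
    where
      concatMap-map : ∀ xs → concatMap (λ x → map (x ∷_) (candidates N k)) xs
                             ≡ cartesianProductWith _∷_ xs (candidates N k)
      concatMap-map [] = refl
      concatMap-map (x ∷ xs) = cong (map (x ∷_) (candidates N k) ++_) (concatMap-map xs)

  Unique-candidates : ∀ N k → Unique (candidates N k)
  Unique-candidates N zero = [] ∷ []
  Unique-candidates N (suc k) rewrite candidates-suc N k =
    Unique.cartesianProductWith⁺ _∷_ List.∷-injective (Unique-fromTo 1 N) (Unique-candidates N k)

  ∈-candidates⁻ : ∀ N k {z} → z ∈ candidates N k → length z ≡ k × All (_∈ fromTo 1 N) z
  ∈-candidates⁻ N zero (here refl) = refl , []
  ∈-candidates⁻ N (suc k) z∈ rewrite candidates-suc N k
    with x , xs , x∈ , xs∈ , refl ← ∈-cartesianProductWith⁻ _∷_ (fromTo 1 N) (candidates N k) z∈ =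
    let len , xs⊆ = ∈-candidates⁻ N k xs∈ in cong suc len , x∈ ∷ xs⊆

  ∈-candidates⁺ : ∀ N {z} → All (_∈ fromTo 1 N) z → z ∈ candidates N (length z)
  ∈-candidates⁺ N [] = here refl
  ∈-candidates⁺ N {x ∷ xs} (x∈ ∷ xs⊆) rewrite candidates-suc N (length xs) =
    ∈-cartesianProductWith⁺ _∷_ x∈ (∈-candidates⁺ N xs⊆)

  record IsPartitionInto (n k : ℕ) (parts : List ℕ) : Set where
    constructor mkPartition
    field
      length≡ : length parts ≡ k
      positive : All (1 ≤_) parts
      nonIncreasing : Linked _≥_ parts
      sum≡ : sum parts ≡ n

  ∈-partitionsInto⁻ : ∀ {n k z} → z ∈ partitionsInto n k → IsPartitionInto n k z
  ∈-partitionsInto⁻ {n} {k} z∈ with z∈cands , ≥z , sum≡ ← ∈-filter⁻ (isPartitionOf? n) {xs = candidates n k} z∈ =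
    let len , z⊆ = ∈-candidates⁻ n k z∈cands in mkPartition len (All.map (proj₁ ∘ ∈-fromTo⁻) z⊆) ≥z sum≡

  ∈-partitionsInto⁺ : ∀ {n k z} → IsPartitionInto n k z → z ∈ partitionsInto n k
  ∈-partitionsInto⁺ {n} (mkPartition refl pos ≥z refl) =
    ∈-filter⁺ (isPartitionOf? n)
      (∈-candidates⁺ n (All.tabulate (λ x∈ → ∈-fromTo⁺ (All.lookup pos x∈) (∈⇒≤sum x∈))))
      (≥z , refl)

  Unique-partitionsInto : ∀ n k → Unique (partitionsInto n k)
  Unique-partitionsInto n k = Unique.filter⁺ (isPartitionOf? n) (Unique-candidates n k)

  σ-≡ : ∀ {m l} → m ∈ l → All (m ≤_) l → σ l ≡ m
  σ-≡ {m} {x ∷ xs} m∈ (m≤x ∷ m≤xs) =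
    ≤-antisym (List.foldr-preservesᵒ (λ y z → [ m≤n⇒m⊓o≤n z , m≤n⇒o⊓m≤n y ]′) x xs (some≤m m∈))
              (List.foldr-preservesᵇ ⊓-glb m≤x m≤xs)
    where
      some≤m : m ∈ x ∷ xs → x ≤ m ⊎ Any (_≤ m) xs
      some≤m (here refl) = inj₁ ≤-refl
      some≤m (there m∈xs) = inj₂ (Any.map (≤-reflexive ∘ sym) m∈xs)

  module _ {m : ℕ} (j : ℕ) {ys : List ℕ} (m<ys : All (m <_) ys) where

    σ-++-replicate : σ (ys ++ replicate (suc j) m) ≡ m
    σ-++-replicate = σ-≡ (∈-++⁺ʳ ys (here refl)) (All.++⁺ (All.map <⇒≤ m<ys) (All.replicate⁺ (suc j) ≤-refl))

    #-++-replicate : # (ys ++ replicate (suc j) m) ≡ suc j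
    #-++-replicate = begin
      length (filter (_≟ σ l) l)
        ≡⟨ cong (λ s → length (filter (_≟ s) l)) σ-++-replicate ⟩
      length (filter (_≟ m) l)
        ≡⟨ cong length (List.filter-++ (_≟ m) ys _) ⟩
      length (filter (_≟ m) ys ++ filter (_≟ m) (replicate (suc j) m))
        ≡⟨ cong₂ (λ u v → length (u ++ v)) (List.filter-none (_≟ m) (All.map (λ m<y → <⇒≢ m<y ∘ sym) m<ys))
                                           (List.filter-all (_≟ m) (All.replicate⁺ (suc j) refl)) ⟩
      length (replicate (suc j) m)
        ≡⟨ List.length-replicate (suc j) ⟩
      suc j ∎
      where
        open ≡-Reasoning
        l = ys ++ replicate (suc j) m

  split-smallest : ∀ {x xs} → Linked _≥_ (x ∷ xs) →
    ∃₂ λ ys m → ∃ λ j → x ∷ xs ≡ ys ++ replicate (suc j) m × All (m <_) ys × Linked _≥_ ys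
  split-smallest {x} {[]} _ = [] , x , 0 , refl , [] , []
  split-smallest {x} {y ∷ xs} (x≥y ∷ ≥xs) with split-smallest ≥xs
  ... | [] , m , j , refl , [] , _ with x ≟ m
  ...   | yes refl = [] , m , suc j , refl , [] , []
  ...   | no x≢m  = x ∷ [] , m , j , refl , ≤∧≢⇒< x≥y (x≢m ∘ sym) ∷ [] , [-]
  split-smallest {x} {y ∷ xs} (x≥y ∷ ≥xs) | y ∷ ys , m , j , refl , m<y ∷ m<ys , ≥ys =
    x ∷ y ∷ ys , m , j , refl , <-≤-trans m<y x≥y ∷ m<y ∷ m<ys , x≥y ∷ ≥ys

  ≥-replicate : ∀ r {m} → Linked _≥_ (replicate r m)
  ≥-replicate zero = []
  ≥-replicate (suc zero) = [-]
  ≥-replicate (suc (suc r)) = ≤-refl ∷ ≥-replicate (suc r)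

  ≥-++-replicate : ∀ r {m ys} → Linked _≥_ ys → All (m ≤_) ys → Linked _≥_ (ys ++ replicate r m)
  ≥-++-replicate r [] [] = ≥-replicate r
  ≥-++-replicate zero [-] (_ ∷ []) = [-]
  ≥-++-replicate (suc r) [-] (m≤y ∷ []) = m≤y ∷ ≥-replicate (suc r)
  ≥-++-replicate r (y≥ ∷ ≥ys) (_ ∷ m≤ys) = y≥ ∷ ≥-++-replicate r ≥ys m≤ys

  attach : ℕ → ℕ → List ℕ → List ℕ
  attach m r μ = map (_+ m) μ ++ replicate r m

  module _ {m r : ℕ} where

    length-attach : ∀ μ → length (attach m r μ) ≡ length μ + r
    length-attach μ = trans (List.length-++ (map (_+ m) μ))
                            (cong₂ _+_ (List.length-map (_+ m) μ) (List.length-replicate r))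

    sum-attach : ∀ μ → sum (attach m r μ) ≡ sum μ + (length μ + r) * m
    sum-attach μ = begin
      sum (map (_+ m) μ ++ replicate r m)
        ≡⟨ sum-++ (map (_+ m) μ) _ ⟩
      sum (map (_+ m) μ) + sum (replicate r m)
        ≡⟨ cong₂ _+_ (sum-map-+ id (λ _ → m) μ) (sum-replicate r m) ⟩
      sum (map id μ) + sum (map (λ _ → m) μ) + r * m
        ≡⟨ cong₂ (λ s t → s + t + r * m) (cong sum (List.map-id μ)) (sum-map-const m μ) ⟩
      sum μ + m * length μ + r * m
        ≡⟨ regroup (sum μ) m (length μ) r ⟩
      sum μ + (length μ + r) * m ∎
      where
        open ≡-Reasoning
        regroup : ∀ s m l r → s + m * l + r * m ≡ s + (l + r) * m
        regroup = solve-∀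

    attach-injective : ∀ {μ μ′} → attach m r μ ≡ attach m r μ′ → μ ≡ μ′
    attach-injective eq = List.map-injective (+-cancelʳ-≡ m _ _) (List.++-cancelʳ (replicate r m) _ _ eq)

    attach-positive : 1 ≤ m → ∀ μ → All (1 ≤_) (attach m r μ)
    attach-positive 1≤m μ =
      All.++⁺ (All.map⁺ (All.tabulate (λ {x} _ → ≤-trans 1≤m (m≤n+m m x)))) (All.replicate⁺ r 1≤m)

    attach-nonIncreasing : ∀ {μ} → Linked _≥_ μ → Linked _≥_ (attach m r μ)
    attach-nonIncreasing ≥μ =
      ≥-++-replicate r (Linked.map⁺ (Linked.map (+-monoˡ-≤ m) ≥μ)) (All.map⁺ (All.tabulate (λ {x} _ → m≤n+m m x)))

    attach-detach : ∀ {ys} → All (m <_) ys → attach m r (map (_∸ m) ys) ≡ ys ++ replicate r m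
    attach-detach {ys} m<ys = cong (_++ replicate r m) (begin
      map (_+ m) (map (_∸ m) ys)   ≡⟨ sym (List.map-∘ ys) ⟩
      map (λ y → y ∸ m + m) ys     ≡⟨ List.map-cong-local (All.map (m∸n+n≡m ∘ <⇒≤) m<ys) ⟩
      map id ys                    ≡⟨ List.map-id ys ⟩
      ys ∎)
      where open ≡-Reasoning

  IsPartitionInto-attach : ∀ {N ν μ m} r → 1 ≤ m → IsPartitionInto N ν μ →
    IsPartitionInto (N + (ν + r) * m) (ν + r) (attach m r μ)
  IsPartitionInto-attach {μ = μ} r 1≤m (mkPartition refl pos ≥μ refl) =
    mkPartition (length-attach μ) (attach-positive 1≤m μ) (attach-nonIncreasing ≥μ) (sum-attach μ)

  +m-above : ∀ {m μ} → All (1 ≤_) μ → All (m <_) (map (_+ m) μ)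
  +m-above {m} pos = All.map⁺ (All.map (+-monoˡ-≤ m) pos)

  σ-attach : ∀ {m r μ} → 0 < r → All (1 ≤_) μ → σ (attach m r μ) ≡ m
  σ-attach {r = suc j} _ pos = σ-++-replicate j (+m-above pos)

  #-attach : ∀ {m r μ} → 0 < r → All (1 ≤_) μ → # (attach m r μ) ≡ r
  #-attach {r = suc j} _ pos = #-++-replicate j (+m-above pos)

  weight-attach : ∀ a b {m r μ} → 0 < r → All (1 ≤_) μ → weight a b (attach m r μ) ≡ m ^ a * r ^ b
  weight-attach a b 0<r pos = cong₂ (λ s c → s ^ a * c ^ b) (σ-attach 0<r pos) (#-attach 0<r pos)

  sum-weight-attach : ∀ a b {m r} N ν → 0 < r →
    sum (map (weight a b) (map (attach m r) (partitionsInto N ν))) ≡ m ^ a * (r ^ b * length (partitionsInto N ν))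
  sum-weight-attach a b {m} {r} N ν 0<r = begin
    sum (map (weight a b) (map (attach m r) P))   ≡⟨ cong sum (sym (List.map-∘ P)) ⟩
    sum (map (weight a b ∘ attach m r) P)         ≡⟨ sum-map-cong-∈ P (weight-attach a b 0<r ∘ positive) ⟩
    sum (map (λ _ → m ^ a * r ^ b) P)             ≡⟨ sum-map-const (m ^ a * r ^ b) P ⟩
    m ^ a * r ^ b * length P                      ≡⟨ *-assoc (m ^ a) _ _ ⟩
    m ^ a * (r ^ b * length P) ∎
    where
      open ≡-Reasoning
      P = partitionsInto N ν
      positive : ∀ {μ} → μ ∈ P → All (1 ≤_) μ
      positive μ∈ = IsPartitionInto.positive (∈-partitionsInto⁻ {N} {ν} μ∈)

  -- The partitions of n into k + 1 parts whose smallest part m occurs exactly k + 1 − ν times.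
  layer : ℕ → ℕ → ℕ → ℕ → List (List ℕ)
  layer n k m ν = map (attach m (suc k ∸ ν)) (partitionsInto (n ∸ suc k * m) ν)

  bySmallestPart : ℕ → ℕ → List (List ℕ)
  bySmallestPart n k = concatMap (λ m → concatMap (layer n k m) (fromTo 0 k)) (fromTo 1 (n / suc k))

  record Layered (n k : ℕ) (z : List ℕ) : Set where
    constructor layered
    field
      {m ν} : ℕ
      {μ} : List ℕ
      1≤m : 1 ≤ m
      m≤n/k : m ≤ n / suc k
      ν≤k : ν ≤ k
      μ∈ : μ ∈ partitionsInto (n ∸ suc k * m) ν
      z≡ : z ≡ attach m (suc k ∸ ν) μ

  module _ {n k : ℕ} where

    ∈-bySmallestPart⁻ : ∀ {z} → z ∈ bySmallestPart n k → Layered n k z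
    ∈-bySmallestPart⁻ z∈
      with m , m∈ , z∈m ← find (∈-concatMap⁻ _ {xs = fromTo 1 (n / suc k)} z∈)
      with ν , ν∈ , z∈mν ← find (∈-concatMap⁻ (layer n k m) {xs = fromTo 0 k} z∈m)
      with μ , μ∈ , z≡ ← ∈-map⁻ (attach m (suc k ∸ ν)) z∈mν =
      layered (proj₁ (∈-fromTo⁻ m∈)) (proj₂ (∈-fromTo⁻ m∈)) (proj₂ (∈-fromTo⁻ {0} ν∈)) μ∈ z≡

    ∈-bySmallestPart⁺ : ∀ {z} → Layered n k z → z ∈ bySmallestPart n k
    ∈-bySmallestPart⁺ (layered {m} {ν} 1≤m m≤n/k ν≤k μ∈ refl) =
      ∈-concatMap⁺ (λ m → concatMap (layer n k m) (fromTo 0 k)) (lose (∈-fromTo⁺ 1≤m m≤n/k)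
        (∈-concatMap⁺ (layer n k m) (lose (∈-fromTo⁺ {0} {k} z≤n ν≤k) (∈-map⁺ (attach m (suc k ∸ ν)) μ∈))))

    Layered⇒∈-partitionsInto : ∀ {z} → Layered n k z → z ∈ partitionsInto n (suc k)
    Layered⇒∈-partitionsInto (layered {m} {ν} {μ} 1≤m m≤n/k ν≤k μ∈ refl) =
      ∈-partitionsInto⁺ (subst₂ (λ N K → IsPartitionInto N K (attach m (suc k ∸ ν) μ)) N≡n ν+r≡k
        (IsPartitionInto-attach (suc k ∸ ν) 1≤m (∈-partitionsInto⁻ μ∈)))
      where
        ν+r≡k : ν + (suc k ∸ ν) ≡ suc k
        ν+r≡k = m+[n∸m]≡n (m≤n⇒m≤1+n ν≤k)
        km≤n : suc k * m ≤ n
        km≤n = ≤-trans (*-monoʳ-≤ (suc k) m≤n/k) (k*[n/k]≤n n (suc k))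
        N≡n : n ∸ suc k * m + (ν + (suc k ∸ ν)) * m ≡ n
        N≡n = trans (cong (λ K → n ∸ suc k * m + K * m) ν+r≡k) (m∸n+n≡m km≤n)

    ∈-partitionsInto⇒Layered : ∀ {z} → z ∈ partitionsInto n (suc k) → Layered n k z
    ∈-partitionsInto⇒Layered {z} z∈ with ∈-partitionsInto⁻ {n} {suc k} z∈
    ∈-partitionsInto⇒Layered {[]} z∈ | mkPartition () _ _ _
    ∈-partitionsInto⇒Layered {x ∷ xs} z∈ | mkPartition len pos ≥z sum≡
      with ys , m , j , z≡ys++ , m<ys , ≥ys ← split-smallest ≥z =
      layered 1≤m (k*m≤n⇒m≤n/k km≤n) ν≤k (∈-partitionsInto⁺ μ-partition)
        (trans z≡attach (cong (λ r → attach m r μ) (sym k∸ν≡)))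
      where
        open ≡-Reasoning
        μ = map (_∸ m) ys
        ν = length μ
        z≡attach : x ∷ xs ≡ attach m (suc j) μ
        z≡attach = trans z≡ys++ (sym (attach-detach m<ys))
        ν+j≡k : ν + suc j ≡ suc k
        ν+j≡k = trans (sym (length-attach μ)) (trans (cong length (sym z≡attach)) len)
        ν≤k : ν ≤ k
        ν≤k = m<1+n⇒m≤n (subst (ν <_) ν+j≡k (m<m+n ν (s≤s z≤n)))
        k∸ν≡ : suc k ∸ ν ≡ suc j
        k∸ν≡ = trans (cong (_∸ ν) (sym ν+j≡k)) (m+n∸m≡n ν (suc j))
        sumμ+km≡n : sum μ + suc k * m ≡ n
        sumμ+km≡n = begin
          sum μ + suc k * m           ≡⟨ cong (λ K → sum μ + K * m) (sym ν+j≡k) ⟩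
          sum μ + (ν + suc j) * m     ≡⟨ sym (sum-attach μ) ⟩
          sum (attach m (suc j) μ)    ≡⟨ cong sum (sym z≡attach) ⟩
          sum (x ∷ xs)                ≡⟨ sum≡ ⟩
          n ∎
        km≤n : suc k * m ≤ n
        km≤n = subst (suc k * m ≤_) sumμ+km≡n (m≤n+m (suc k * m) (sum μ))
        1≤m : 1 ≤ m
        1≤m = All.lookup pos (subst (m ∈_) (sym z≡ys++) (∈-++⁺ʳ ys (here refl)))
        μ-partition : IsPartitionInto (n ∸ suc k * m) ν μ
        μ-partition = mkPartition refl (All.map⁺ (All.map m<n⇒0<n∸m m<ys)) (Linked.map⁺ (Linked.map (∸-monoˡ-≤ m) ≥ys))
          (trans (sym (m+n∸n≡m (sum μ) (suc k * m))) (cong (_∸ suc k * m) sumμ+km≡n))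

    Unique-bySmallestPart : Unique (bySmallestPart n k)
    Unique-bySmallestPart =
      Unique-concatMap _ σ (Unique-fromTo 1 (n / suc k))
        (λ {m} _ → Unique-concatMap (layer n k m) (λ z → suc k ∸ # z) (Unique-fromTo 0 k)
                     (λ {ν} _ → Unique.map⁺ attach-injective (Unique-partitionsInto (n ∸ suc k * m) ν)) multiplicity)
        smallest
      where
        positive : ∀ {m ν z} → z ∈ layer n k m ν → ∃ λ μ → All (1 ≤_) μ × z ≡ attach m (suc k ∸ ν) μ
        positive {m} {ν} z∈ with μ , μ∈ , z≡ ← ∈-map⁻ _ z∈ =
          μ , IsPartitionInto.positive (∈-partitionsInto⁻ {n ∸ suc k * m} {ν} μ∈) , z≡
        multiplicity : ∀ {m ν z} → ν ∈ fromTo 0 k → z ∈ layer n k m ν → suc k ∸ # z ≡ ν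
        multiplicity {m} {ν} ν∈ z∈ with μ , pos , refl ← positive {m} {ν} z∈ =
          trans (cong (suc k ∸_) (#-attach (ν≤k⇒0<1+k∸ν ν≤k) pos)) (m∸[m∸n]≡n (m≤n⇒m≤1+n ν≤k))
          where ν≤k = proj₂ (∈-fromTo⁻ {0} ν∈)
        smallest : ∀ {m z} → m ∈ fromTo 1 (n / suc k) → z ∈ concatMap (layer n k m) (fromTo 0 k) → σ z ≡ m
        smallest {m} _ z∈
          with ν , ν∈ , z∈mν ← find (∈-concatMap⁻ (layer n k m) {xs = fromTo 0 k} z∈)
          with μ , pos , refl ← positive {m} {ν} z∈mν =
          σ-attach (ν≤k⇒0<1+k∸ν (proj₂ (∈-fromTo⁻ {0} ν∈))) pos

  spt-bySmallestPart : ∀ a b n k → spt[_,_]⟨_,_⟩ a b n (suc k) ≡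
    Σ[ 1 ⋯ n / suc k ] (λ m → m ^ a * Σ[ 0 ⋯ k ] (λ ν → (suc k ∸ ν) ^ b * length (partitionsInto (n ∸ suc k * m) ν)))
  spt-bySmallestPart a b n k = begin
    sum (map w (partitionsInto n (suc k)))
      ≡⟨ unique∧set⇒sum-map≡ w (Unique-partitionsInto n (suc k)) (Unique-bySmallestPart {n} {k})
           (∈-bySmallestPart⁺ ∘ ∈-partitionsInto⇒Layered {n} {k})
           (Layered⇒∈-partitionsInto ∘ ∈-bySmallestPart⁻ {n} {k}) ⟩
    sum (map w (bySmallestPart n k))
      ≡⟨ sum-map-concatMap w _ (fromTo 1 (n / suc k)) ⟩
    Σ[ 1 ⋯ n / suc k ] (λ m → sum (map w (concatMap (layer n k m) (fromTo 0 k))))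
      ≡⟨ Σ-cong {1} {n / suc k} (λ {m} _ _ → weight-layers m) ⟩
    Σ[ 1 ⋯ n / suc k ] (λ m → m ^ a * Σ[ 0 ⋯ k ] (λ ν → (suc k ∸ ν) ^ b * length (partitionsInto (n ∸ suc k * m) ν))) ∎
    where
      open ≡-Reasoning
      w = weight a b
      weight-layers : ∀ m → sum (map w (concatMap (layer n k m) (fromTo 0 k)))
                            ≡ m ^ a * Σ[ 0 ⋯ k ] (λ ν → (suc k ∸ ν) ^ b * length (partitionsInto (n ∸ suc k * m) ν))
      weight-layers m = begin
        sum (map w (concatMap (layer n k m) (fromTo 0 k)))
          ≡⟨ sum-map-concatMap w (layer n k m) (fromTo 0 k) ⟩
        Σ[ 0 ⋯ k ] (λ ν → sum (map w (layer n k m ν)))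
          ≡⟨ Σ-cong {0} {k} (λ {ν} _ ν≤k → sum-weight-attach a b (n ∸ suc k * m) ν (ν≤k⇒0<1+k∸ν ν≤k)) ⟩
        Σ[ 0 ⋯ k ] (λ ν → m ^ a * ((suc k ∸ ν) ^ b * length (partitionsInto (n ∸ suc k * m) ν)))
          ≡⟨ sum-map-*ˡ (m ^ a) _ (fromTo 0 k) ⟩
        m ^ a * Σ[ 0 ⋯ k ] (λ ν → (suc k ∸ ν) ^ b * length (partitionsInto (n ∸ suc k * m) ν)) ∎

  δ₀ : ℕ → ℕ
  δ₀ zero = 1
  δ₀ (suc _) = 0

  δ₀-pos : ∀ {N} → 0 < N → δ₀ N ≡ 0
  δ₀-pos (s≤s _) = refl

  δ₀-∸ : ∀ {x n} .{{_ : NonZero n}} → x ≤ n → δ₀ (n ∸ x) ≡ x / n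
  δ₀-∸ {x} {n} x≤n with m≤n⇒m<n∨m≡n x≤n
  ... | inj₁ x<n = trans (δ₀-pos (m<n⇒0<n∸m x<n)) (sym (m<n⇒m/n≡0 x<n))
  ... | inj₂ refl = trans (cong δ₀ (n∸n≡0 n)) (sym (n/n≡1 n))

  Σ-δ₀ : ∀ (f : ℕ → ℕ) {n k} q .{{_ : NonZero n}} .{{_ : NonZero k}} → k * q ≤ n →
    Σ[ 1 ⋯ q ] (λ m → f m * δ₀ (n ∸ k * m)) ≡ f q * ((k * q) / n)
  Σ-δ₀ f {n} {k} zero _ =
    sym (trans (cong (λ x → f 0 * (x / n)) (*-zeroʳ k)) (trans (cong (f 0 *_) (0/n≡0 n)) (*-zeroʳ (f 0))))
  Σ-δ₀ f {n} {k} (suc q) kq≤n = begin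
    Σ[ 1 ⋯ suc q ] g
      ≡⟨ Σ-snoc g (s≤s z≤n) ⟩
    Σ[ 1 ⋯ q ] g + g (suc q)
      ≡⟨ cong₂ _+_ (Σ-cong below) (cong (f (suc q) *_) (δ₀-∸ kq≤n)) ⟩
    Σ[ 1 ⋯ q ] (λ _ → 0) + f (suc q) * ((k * suc q) / n)
      ≡⟨ cong (_+ f (suc q) * ((k * suc q) / n)) (sum-map-const 0 (fromTo 1 q)) ⟩
    f (suc q) * ((k * suc q) / n) ∎
    where
      open ≡-Reasoning
      g = λ m → f m * δ₀ (n ∸ k * m)
      below : ∀ {m} → 1 ≤ m → m ≤ q → g m ≡ 0
      below {m} _ m≤q =
        trans (cong (f m *_) (δ₀-pos (m<n⇒0<n∸m (<-≤-trans (*-monoʳ-< k (s≤s m≤q)) kq≤n)))) (*-zeroʳ (f m))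

  length-partitionsInto-0 : ∀ N → length (partitionsInto N 0) ≡ δ₀ N
  length-partitionsInto-0 zero = refl
  length-partitionsInto-0 (suc N) = refl

  p-1 : ∀ N → p N 1 ≡ length (partitionsInto N 1) + δ₀ N
  p-1 zero = refl
  p-1 (suc N) = sym (+-identityʳ _)

  p-≥2 : ∀ N {ν} → 2 ≤ ν → p N ν ≡ length (partitionsInto N ν)
  p-≥2 zero (s≤s (s≤s _)) = refl
  p-≥2 (suc N) (s≤s (s≤s _)) = refl

  Σ-p≡Σ-length+δ₀ : ∀ b → 1 ≤ b → ∀ k N →
    Σ[ 1 ⋯ k ] (λ ν → (suc k ∸ ν) ^ b * p N ν)
      ≡ Σ[ 1 ⋯ k ] (λ ν → (suc k ∸ ν) ^ b * length (partitionsInto N ν)) + k ^ b * δ₀ N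
  Σ-p≡Σ-length+δ₀ (suc b) _ zero N = refl
  Σ-p≡Σ-length+δ₀ b _ (suc k) N = begin
    c * p N 1 + Σ[ 2 ⋯ suc k ] (λ ν → (suc (suc k) ∸ ν) ^ b * p N ν)
      ≡⟨ cong₂ _+_ (cong (c *_) (p-1 N))
                   (Σ-cong {2} {suc k} (λ {ν} 2≤ν _ → cong ((suc (suc k) ∸ ν) ^ b *_) (p-≥2 N 2≤ν))) ⟩
    c * (L 1 + δ₀ N) + S
      ≡⟨ rearrange c (L 1) (δ₀ N) S ⟩
    c * L 1 + S + c * δ₀ N ∎
    where
      open ≡-Reasoning
      c = suc k ^ b
      L = length ∘ partitionsInto N
      S = Σ[ 2 ⋯ suc k ] (λ ν → (suc (suc k) ∸ ν) ^ b * L ν)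
      rearrange : ∀ c l d s → c * (l + d) + s ≡ c * l + s + c * d
      rearrange = solve-∀

  Σ-length≡δ₀+Σ-p : ∀ b → 1 ≤ b → ∀ k N →
    Σ[ 0 ⋯ k ] (λ ν → (suc k ∸ ν) ^ b * length (partitionsInto N ν))
      ≡ (suc k ^ b ∸ k ^ b) * δ₀ N + Σ[ 1 ⋯ k ] (λ ν → (suc k ∸ ν) ^ b * p N ν)
  Σ-length≡δ₀+Σ-p b 1≤b k N = begin
    suc k ^ b * length (partitionsInto N 0) + S
      ≡⟨ cong (λ x → suc k ^ b * x + S) (length-partitionsInto-0 N) ⟩
    suc k ^ b * δ₀ N + S
      ≡⟨ cong (λ x → x * δ₀ N + S) (sym (m∸n+n≡m (^-monoˡ-≤ b (n≤1+n k)))) ⟩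
    (suc k ^ b ∸ k ^ b + k ^ b) * δ₀ N + S
      ≡⟨ rearrange (suc k ^ b ∸ k ^ b) (k ^ b) (δ₀ N) S ⟩
    (suc k ^ b ∸ k ^ b) * δ₀ N + (S + k ^ b * δ₀ N)
      ≡⟨ cong ((suc k ^ b ∸ k ^ b) * δ₀ N +_) (sym (Σ-p≡Σ-length+δ₀ b 1≤b k N)) ⟩
    (suc k ^ b ∸ k ^ b) * δ₀ N + Σ[ 1 ⋯ k ] (λ ν → (suc k ∸ ν) ^ b * p N ν) ∎
    where
      open ≡-Reasoning
      S = Σ[ 1 ⋯ k ] (λ ν → (suc k ∸ ν) ^ b * length (partitionsInto N ν))
      rearrange : ∀ x y d s → (x + y) * d + s ≡ x * d + (s + y * d)
      rearrange = solve-∀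

  spt-into-formula : ∀ a b → 1 ≤ b → ∀ n k .{{_ : NonZero n}} →
    spt[_,_]⟨_,_⟩ a b n (suc k)
      ≡ (n / suc k) ^ a * ((suc k * (n / suc k)) / n) * (suc k ^ b ∸ k ^ b)
        + Σ[ 1 ⋯ n / suc k ] (λ m → m ^ a * Σ[ 1 ⋯ k ] (λ ν → (suc k ∸ ν) ^ b * p (n ∸ suc k * m) ν))
  spt-into-formula a b 1≤b n k = begin
    spt[_,_]⟨_,_⟩ a b n (suc k)
      ≡⟨ spt-bySmallestPart a b n k ⟩
    Σ[ 1 ⋯ q ] (λ m → m ^ a * Σ[ 0 ⋯ k ] (λ ν → (suc k ∸ ν) ^ b * length (partitionsInto (N m) ν)))
      ≡⟨ Σ-cong {1} {q} (λ {m} _ _ → trans (cong (m ^ a *_) (Σ-length≡δ₀+Σ-p b 1≤b k (N m)))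
                                           (distrib (m ^ a) c (δ₀ (N m)) (T m))) ⟩
    Σ[ 1 ⋯ q ] (λ m → c * (m ^ a * δ₀ (N m)) + m ^ a * T m)
      ≡⟨ sum-map-+ (λ m → c * (m ^ a * δ₀ (N m))) (λ m → m ^ a * T m) (fromTo 1 q) ⟩
    Σ[ 1 ⋯ q ] (λ m → c * (m ^ a * δ₀ (N m))) + Σ[ 1 ⋯ q ] (λ m → m ^ a * T m)
      ≡⟨ cong (_+ Σ[ 1 ⋯ q ] (λ m → m ^ a * T m)) (trans (sum-map-*ˡ c _ (fromTo 1 q)) (*-comm c _)) ⟩
    Σ[ 1 ⋯ q ] (λ m → m ^ a * δ₀ (N m)) * c + Σ[ 1 ⋯ q ] (λ m → m ^ a * T m)
      ≡⟨ cong (λ x → x * c + Σ[ 1 ⋯ q ] (λ m → m ^ a * T m)) (Σ-δ₀ (_^ a) {n} {suc k} q (k*[n/k]≤n n (suc k))) ⟩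
    q ^ a * ((suc k * q) / n) * c + Σ[ 1 ⋯ q ] (λ m → m ^ a * T m) ∎
    where
      open ≡-Reasoning
      q = n / suc k
      c = suc k ^ b ∸ k ^ b
      N = λ m → n ∸ suc k * m
      T = λ m → Σ[ 1 ⋯ k ] (λ ν → (suc k ∸ ν) ^ b * p (N m) ν)
      distrib : ∀ x c d t → x * (c * d + t) ≡ c * (x * d) + x * t
      distrib = solve-∀

  spt≡Σ-spt-into : ∀ a b n → spt[_,_]⟨_⟩ a b (suc n) ≡ Σ[ 0 ⋯ n ] (λ j → spt[_,_]⟨_,_⟩ a b (suc n) (suc j))
  spt≡Σ-spt-into a b n = begin
    sum (map w (filter (isPartitionOf? (suc n)) (concatMap (candidates (suc n)) (fromTo 0 (suc n)))))
      ≡⟨ cong (sum ∘ map w) (filter-concatMap (isPartitionOf? (suc n)) (candidates (suc n)) (fromTo 0 (suc n))) ⟩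
    sum (map w (concatMap (partitionsInto (suc n)) (fromTo 0 (suc n))))
      ≡⟨ sum-map-concatMap w (partitionsInto (suc n)) (fromTo 0 (suc n)) ⟩
    spt[_,_]⟨_,_⟩ a b (suc n) 0 + Σ[ 1 ⋯ suc n ] (spt[_,_]⟨_,_⟩ a b (suc n))
      -- partitionsInto (suc n) 0 computes to [].
      ≡⟨⟩
    Σ[ 1 ⋯ suc n ] (spt[_,_]⟨_,_⟩ a b (suc n))
      ≡⟨ Σ-shift 0 n (spt[_,_]⟨_,_⟩ a b (suc n)) ⟩
    Σ[ 0 ⋯ n ] (λ j → spt[_,_]⟨_,_⟩ a b (suc n) (suc j)) ∎
    where
      open ≡-Reasoning
      w = weight a b

corollary6 : (n a b : ℕ) → .{{_ : NonZero n}} → 1 ≤ n → 1 ≤ a → 1 ≤ b →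
    ((k : ℕ) → .{{_ : NonZero k}} → 1 ≤ k →
      spt[ a , b ]⟨ n , k ⟩
        ≡ (n / k) ^ a * ((k * (n / k)) / n) * (k ^ b ∸ (k ∸ 1) ^ b)
          + Σ[ 1 ⋯ n / k ] (λ m → m ^ a * Σ[ 1 ⋯ k ∸ 1 ] (λ ν → (k ∸ ν) ^ b * p (n ∸ k * m) ν)))
    × (spt[ a , b ]⟨ n ⟩
        ≡ Σ[ 0 ⋯ n ∸ 1 ] (λ j → let k = suc j in (n / k) ^ a * ((k * (n / k)) / n) * (k ^ b ∸ (k ∸ 1) ^ b)
          + Σ[ 1 ⋯ n / k ] (λ m → m ^ a * Σ[ 1 ⋯ k ∸ 1 ] (λ ν → (k ∸ ν) ^ b * p (n ∸ k * m) ν))))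
corollary6 (suc n) a b _ _ 1≤b =
    (λ { (suc k) _ → spt-into-formula a b 1≤b (suc n) k })
  , trans (spt≡Σ-spt-into a b n) (Σ-cong {0} {n} (λ {j} _ _ → spt-into-formula a b 1≤b (suc n) j))
  where open Data.Product using (_,_)
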